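{- Let $G_1$ and $G_2$ be minimal non-word-representable graphs, and let $H = G_1 \circ G_2$. Then $\mu(H) \le 3$.
   Context: All graphs are simple, undirected and finite. A graph is word-representable if there is a word $w$ over its vertex set such that two distinct vertices are adjacent iff their occurrences alternate in $w$. A graph is minimal non-word-representable if it is not word-representable but all its proper induced subgraphs are word-representable. The union of graphs $G_1,\dots,G_k$ is the graph with vertex set $\bigcup V(G_i)$ and edge set $\bigcup E(G_i)$. The multi-word-representation number $\mu(G)$ is the smallest positive integer $k$ such that $G$ is the union of $k$ word-representable graphs. The lexicographic product $G_1 \circ G_2$ has vertex set $V(G_1)\times V(G_2)$, with $(u,v)$ and $(x,y)$ adjacent iff $\{u,x\}\in E(G_1)$, or $u=x$ and $\{v,y\}\in E(G_2)$. -}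

module Defs where

open import Data.Nat using (ℕ; _<_; _≤_)
open import Data.Fin using (Fin; remQuot; _≟_)
open import Data.Bool using (Bool; true; false)
open import Data.List using (List; filter)
open import Data.List.Membership.Propositional using (_∈_)
open import Data.List.Relation.Unary.Linked using (Linked)
open import Data.Product using (Σ; ∃; ∃-syntax; _×_; _,_; proj₁; proj₂)
open import Relation.Nullary using (¬_; yes; no)
open import Relation.Nullary.Decidable using (_⊎-dec_)
open import Relation.Binary.PropositionalEquality using (_≡_; _≢_; refl; sym)
open import Function.Definitions using (Injective)
open import Function.Bundles using (_⇔_)

record Graph (n : ℕ) : Set where
  field
    adj        : Fin n → Fin n → Bool
    adj-sym    : ∀ x y → adj x y ≡ adj y x
    adj-irrefl : ∀ x → adj x x ≡ false
open Graph public

Adjacent : ∀ {n} → Graph n → Fin n → Fin n → Set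
Adjacent G x y = adj G x y ≡ true

restrict : ∀ {n} → Fin n → Fin n → List (Fin n) → List (Fin n)
restrict x y = filter (λ z → (z ≟ x) ⊎-dec (z ≟ y))

Alternate : ∀ {n} → Fin n → Fin n → List (Fin n) → Set
Alternate x y w = Linked _≢_ (restrict x y w)

Represents : ∀ {n} → Graph n → List (Fin n) → Set
Represents {n} G w =
  (∀ (v : Fin n) → v ∈ w) ×
  (∀ (x y : Fin n) → x ≢ y → (Adjacent G x y ⇔ Alternate x y w))

WordRepresentable : ∀ {n} → Graph n → Set
WordRepresentable {n} G = ∃[ w ] Represents G w

-- Induced subgraph on the image of f (f injective in uses below).
induce : ∀ {m n} → Graph n → (Fin m → Fin n) → Graph m
induce G f = record
  { adj        = λ a b → adj G (f a) (f b)
  ; adj-sym    = λ a b → adj-sym G (f a) (f b)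
  ; adj-irrefl = λ a → adj-irrefl G (f a)
  }

-- Minimal non-word-representable: not word-representable, but every proper
-- induced subgraph (vertex set = image of an injection Fin m → Fin n, m < n)
-- is word-representable.
MinimalNonWR : ∀ {n} → Graph n → Set
MinimalNonWR {n} G =
  ¬ WordRepresentable G ×
  (∀ (m : ℕ) → m < n → (f : Fin m → Fin n) → Injective _≡_ _≡_ f →
     WordRepresentable (induce G f))

-- Lexicographic product G₁ ∘ G₂ on Fin (n₁ * n₂), vertex i ↔ remQuot i.
lexAdj : ∀ {n₁ n₂} → Graph n₁ → Graph n₂ →
         Fin n₁ → Fin n₂ → Fin n₁ → Fin n₂ → Bool
lexAdj G₁ G₂ u v x y with u ≟ x
... | yes _ = adj G₂ v y
... | no  _ = adj G₁ u x

lexAdj-sym : ∀ {n₁ n₂} (G₁ : Graph n₁) (G₂ : Graph n₂) u v x y →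
             lexAdj G₁ G₂ u v x y ≡ lexAdj G₁ G₂ x y u v
lexAdj-sym G₁ G₂ u v x y with u ≟ x | x ≟ u
... | yes _   | yes _ = adj-sym G₂ v y
... | yes u≡x | no x≢u = Data.Empty.⊥-elim (x≢u (sym u≡x))
  where import Data.Empty
... | no u≢x  | yes x≡u = Data.Empty.⊥-elim (u≢x (sym x≡u))
  where import Data.Empty
... | no _    | no _ = adj-sym G₁ u x

lexAdj-irrefl : ∀ {n₁ n₂} (G₁ : Graph n₁) (G₂ : Graph n₂) u v →
                lexAdj G₁ G₂ u v u v ≡ false
lexAdj-irrefl G₁ G₂ u v with u ≟ u
... | yes _ = adj-irrefl G₂ v
... | no u≢u = Data.Empty.⊥-elim (u≢u refl)
  where import Data.Empty

lex : ∀ {n₁ n₂} → Graph n₁ → Graph n₂ → Graph (n₁ Data.Nat.* n₂)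
lex {n₁} {n₂} G₁ G₂ = record
  { adj        = λ i j → lexAdj G₁ G₂ (q i) (r i) (q j) (r j)
  ; adj-sym    = λ i j → lexAdj-sym G₁ G₂ (q i) (r i) (q j) (r j)
  ; adj-irrefl = λ i → lexAdj-irrefl G₁ G₂ (q i) (r i)
  }
  where
  import Data.Nat
  q : Fin (n₁ Data.Nat.* n₂) → Fin n₁
  q i = proj₁ (remQuot {n₁} n₂ i)
  r : Fin (n₁ Data.Nat.* n₂) → Fin n₂
  r i = proj₂ (remQuot {n₁} n₂ i)

-- H (on Fin n) is the union of k word-representable graphs G_i, each given
-- with an injective labelling of its vertices by vertices of H:
-- V(H) = ⋃ V(G_i) and E(H) = ⋃ E(G_i).
record WRUnion {n : ℕ} (H : Graph n) (k : ℕ) : Set where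
  field
    size      : Fin k → ℕ
    part      : (i : Fin k) → Graph (size i)
    embed     : (i : Fin k) → Fin (size i) → Fin n
    embed-inj : ∀ i → Injective _≡_ _≡_ (embed i)
    part-wr   : ∀ i → WordRepresentable (part i)
    vertices  : ∀ (v : Fin n) → ∃[ i ] ∃[ a ] embed i a ≡ v
    edges     : ∀ (u v : Fin n) →
                (Adjacent H u v ⇔
                 (∃[ i ] ∃[ a ] ∃[ b ]
                   (embed i a ≡ u × embed i b ≡ v × Adjacent (part i) a b)))

μ≤ : ∀ {n} → Graph n → ℕ → Set
μ≤ H k = ∃[ j ] (1 ≤ j × j ≤ k × WRUnion H j)

-- Let v = zero. By minimality Gᵢ - v is word-representable, and Gᵢ is the union of Iᵢ (that is Gᵢ - v
-- with v put back as an isolated vertex) and the star Sᵢ of the edges at v. With K̄ edgeless on V(G₁),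
--
--   G₁ ∘ G₂  =  (I₁ ∘ S₂) ∪ (S₁ ∘ S₂) ∪ (K̄ ∘ I₂),
--
-- and the three graphs are word-representable:
-- * Iᵢ is represented by v v w when w represents Gᵢ - v; a star with isolated vertices is a permutation
--   graph, represented by a concatenation σ₁ σ₂ of permutations (x ~ y iff σ₁, σ₂ order x, y alike).
-- * If w represents G then so does π w, where π lists the letters in order of first occurrence. Blowing
--   up the first occurrence of each letter a into σ₁ over a, and the later ones into σ₂ over a, gives a
--   word for G ∘ S, S the permutation graph of σ₁, σ₂.
-- * One copy of π w over each vertex of K̄ gives a word for K̄ ∘ I₂, since every letter occurs in π w at
--   least twice, so that letters over distinct vertices of K̄ never alternate.

module Submission where

open import Defs hiding (restrict; Alternate)

open import Level using (Level)
open import Data.Bool using (Bool; true; false; T; not; _∨_; if_then_else_)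
open import Data.Bool.Properties using (∨-identityʳ; ∨-comm; ∨-assoc; ∨-idem; T-≡; T-∨)
open import Data.Nat using (ℕ; zero; suc; _*_; s≤s; z≤n)
open import Data.Nat.Properties using (≤-refl; n<1+n)
open import Data.Fin using (Fin; zero; suc; combine; remQuot) renaming (_≟_ to _≟ᶠ_)
open import Data.Fin.Properties using (suc-injective; remQuot-combine; combine-remQuot)
open import Data.Empty using (⊥-elim)
open import Data.Unit using (tt)
open import Data.List
  using (List; []; _∷_; _++_; [_]; map; cartesianProduct; reverse; filter; filterᵇ; deduplicate; allFin; tabulate)
open import Data.List.Properties
  using ( cartesianProductWith-distribʳ-++; map-++; map-tabulate; filter-++; filter-reject; filter-all
        ; filter-none; filter-≐; unfold-reverse; ++-identityʳ; ∷-injectiveˡ; ∷-injectiveʳ)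
open import Data.List.Membership.Propositional using (_∈_)
open import Data.List.Membership.Propositional.Properties
  using (∈-filter⁺; ∈-filter⁻; ∈-∃++; ∈-map⁺; ∈-++⁺ˡ; ∈-++⁺ʳ; ∈-allFin; ∈-cartesianProduct⁺)
open import Data.List.Relation.Unary.All as All using (All; _∷_)
open import Data.List.Relation.Unary.All.Properties using (all-filter; deduplicate⁺)
open import Data.List.Relation.Unary.Any using (here; there)
open import Data.List.Relation.Unary.Linked as Linked using (Linked; []; [-]; _∷_)
open import Data.List.Relation.Unary.Linked.Properties as Linkedₚ using ()
open import Data.Product using (∃-syntax; ∃₂; _×_; _,_; proj₁; proj₂; uncurry)
open import Data.Product.Properties using (≡-dec)
open import Data.Product.Function.Dependent.Propositional using () renaming (congˡ to ∃-cong)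
open import Data.Sum as Sum using (_⊎_; inj₁; inj₂; swap)
open import Function using (_∘_; _⇔_; mk⇔; const; id; Equivalence)
open import Function.Related.Propositional using (module EquationalReasoning)
open import Function.Properties.Equivalence using () renaming (sym to ⇔-sym)
open import Function.Definitions using (Injective)
open import Relation.Binary.Definitions using (DecidableEquality)
open import Relation.Binary.PropositionalEquality
  using (_≡_; _≢_; refl; sym; trans; cong; cong₂; subst; subst₂; module ≡-Reasoning)
open import Relation.Nullary using (¬_; Dec; yes; no; does; ¬?)
open import Relation.Nullary.Decidable using (_⊎-dec_; _×-dec_; dec-true; dec-false; does-⇔)
open import Relation.Unary using (Pred; Decidable)

private
  variable
    ℓ ℓ₁ ℓ₂ : Level
    A B : Set ℓ

module _ {P : Pred A ℓ₁} (P? : Decidable P) where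
  open ≡-Reasoning

  filter-map : (f : B → A) (xs : List B) → filter P? (map f xs) ≡ map f (filter (P? ∘ f) xs)
  filter-map f [] = refl
  filter-map f (x ∷ xs) with does (P? (f x))
  ... | true  = cong (f x ∷_) (filter-map f xs)
  ... | false = filter-map f xs

  filter-reverse : (xs : List A) → filter P? (reverse xs) ≡ reverse (filter P? xs)
  filter-reverse [] = refl
  filter-reverse (x ∷ xs) = begin
    filter P? (reverse (x ∷ xs))              ≡⟨ cong (filter P?) (unfold-reverse x xs) ⟩
    filter P? (reverse xs ++ [ x ])           ≡⟨ filter-++ P? (reverse xs) [ x ] ⟩
    filter P? (reverse xs) ++ filter P? [ x ] ≡⟨ cong (_++ filter P? [ x ]) (filter-reverse xs) ⟩
    reverse (filter P? xs) ++ filter P? [ x ] ≡⟨ append-last ⟩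
    reverse (filter P? (x ∷ xs))              ∎
    where
    append-last : reverse (filter P? xs) ++ filter P? [ x ] ≡ reverse (filter P? (x ∷ xs))
    append-last with does (P? x)
    ... | true  = sym (unfold-reverse x (filter P? xs))
    ... | false = ++-identityʳ _

  filter-comm : {Q : Pred A ℓ₂} (Q? : Decidable Q) (xs : List A) →
                filter P? (filter Q? xs) ≡ filter Q? (filter P? xs)
  filter-comm Q? [] = refl
  filter-comm Q? (x ∷ xs) with does (P? x) in p | does (Q? x) in q
  ... | true  | true  rewrite p | q = cong (x ∷_) (filter-comm Q? xs)
  ... | true  | false rewrite q     = filter-comm Q? xs
  ... | false | true  rewrite p     = filter-comm Q? xs
  ... | false | false               = filter-comm Q? xs

  filter-deduplicate : (_≟_ : DecidableEquality A) (xs : List A) →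
                       filter P? (deduplicate _≟_ xs) ≡ deduplicate _≟_ (filter P? xs)
  filter-deduplicate _≟_ [] = refl
  filter-deduplicate _≟_ (x ∷ xs) with P? x
  ... | yes _  = cong (x ∷_) (begin
    filter P? (filter x≢? (deduplicate _≟_ xs))   ≡⟨ filter-comm x≢? (deduplicate _≟_ xs) ⟩
    filter x≢? (filter P? (deduplicate _≟_ xs))   ≡⟨ cong (filter x≢?) (filter-deduplicate _≟_ xs) ⟩
    filter x≢? (deduplicate _≟_ (filter P? xs))   ∎)
    where
    x≢? : Decidable (x ≢_)
    x≢? = ¬? ∘ (x ≟_)
  ... | no ¬px = begin
    filter P? (filter x≢? (deduplicate _≟_ xs))   ≡⟨ filter-comm x≢? (deduplicate _≟_ xs) ⟩
    filter x≢? (filter P? (deduplicate _≟_ xs))   ≡⟨ cong (filter x≢?) (filter-deduplicate _≟_ xs) ⟩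
    filter x≢? (deduplicate _≟_ (filter P? xs))
      ≡⟨ filter-all x≢? (All.map P⇒≢x (deduplicate⁺ _≟_ (all-filter P? xs))) ⟩
    deduplicate _≟_ (filter P? xs)                 ∎
    where
    x≢? : Decidable (x ≢_)
    x≢? = ¬? ∘ (x ≟_)
    P⇒≢x : ∀ {z} → P z → x ≢ z
    P⇒≢x pz refl = ¬px pz

module _ {A : Set ℓ} where

  linked-map-injective : {f : A → B} → Injective _≡_ _≡_ f → (xs : List A) →
                         Linked _≢_ (map f xs) ⇔ Linked _≢_ xs
  linked-map-injective {f = f} f-injective xs =
    mk⇔ (λ l → Linked.map (λ fx≢fy x≡y → fx≢fy (cong f x≡y)) (Linkedₚ.map⁻ l))
        (λ l → Linkedₚ.map⁺ (Linked.map (λ x≢y fx≡fy → x≢y (f-injective fx≡fy)) l))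

  ¬linked-repeat : ∀ (xs : List A) {z} ys → ¬ Linked _≢_ (xs ++ z ∷ z ∷ ys)
  ¬linked-repeat []       ys (z≢z ∷ _) = z≢z refl
  ¬linked-repeat (_ ∷ xs) ys l         = ¬linked-repeat xs ys (Linked.tail l)

module Words {A : Set} (_≟_ : DecidableEquality A) where

  restrict : A → A → List A → List A
  restrict x y = filter (λ z → (z ≟ x) ⊎-dec (z ≟ y))

  Alternate : A → A → List A → Set
  Alternate x y w = Linked _≢_ (restrict x y w)

  occurrences : A → List A → List A
  occurrences x = filter (_≟ x)

  OccursOnce : A → List A → Set
  OccursOnce x w = occurrences x w ≡ [ x ]

  IsPermutation : List A → Set
  IsPermutation σ = ∀ x → OccursOnce x σ

  Arrangement : A → A → List A → Set
  Arrangement x y r = r ≡ x ∷ y ∷ [] ⊎ r ≡ y ∷ x ∷ []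

  Realises : List A → (A → A → Bool) → Set
  Realises w E = ∀ x y → x ≢ y → Alternate x y w ⇔ T (E x y)

  -- E is the permutation graph of σ₁ and σ₂: on a permutation, restrict x y is the order of x and y.
  PermutationsRealise : List A → List A → (A → A → Bool) → Set
  PermutationsRealise σ₁ σ₂ E = ∀ x y → x ≢ y → restrict x y σ₁ ≡ restrict x y σ₂ ⇔ T (E x y)

  restrict-sym : ∀ x y w → restrict x y w ≡ restrict y x w
  restrict-sym x y = filter-≐ _ _ (swap , swap)

  occursOnce⇒∈ : ∀ {x w} → OccursOnce x w → x ∈ w
  occursOnce⇒∈ {x} once = proj₁ (∈-filter⁻ (_≟ x) (subst (x ∈_) (sym once) (here refl)))

  occurrences-∈ : ∀ {x w} → x ∈ w → ∃[ ys ] occurrences x w ≡ x ∷ ys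
  occurrences-∈ {x} {w} x∈w with occurrences x w | ∈-filter⁺ (_≟ x) x∈w refl | all-filter (_≟ x) w
  ... | _ ∷ ys | _ | refl ∷ _ = ys , refl

  restrict-∈ : ∀ {x w} y → x ∈ w → ∃₂ λ c r → restrict x y w ≡ c ∷ r
  restrict-∈ {x} {w} y x∈w
    with restrict x y w | ∈-filter⁺ (λ z → (z ≟ x) ⊎-dec (z ≟ y)) x∈w (inj₁ refl)
  ... | c ∷ r | _ = c , r , refl

  restrict-absent : ∀ {x} y w → occurrences x w ≡ [] → restrict x y w ≡ occurrences y w
  restrict-absent y []      _ = refl
  restrict-absent {x} y (z ∷ w) no-x with z ≟ x
  restrict-absent y (z ∷ w) () | yes refl
  ... | no _ with z ≟ y
  ...   | yes _ = cong (z ∷_) (restrict-absent y w no-x)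
  ...   | no _  = restrict-absent y w no-x

  restrict-arrangement : ∀ {x y} w → x ≢ y → OccursOnce x w → OccursOnce y w →
                         Arrangement x y (restrict x y w)
  restrict-arrangement [] _ () _
  restrict-arrangement {x} {y} (z ∷ w) x≢y once-x once-y with z ≟ x | z ≟ y
  ... | yes refl | yes refl = ⊥-elim (x≢y refl)
  ... | yes refl | no _     =
    inj₁ (cong (x ∷_) (trans (restrict-absent y w (∷-injectiveʳ once-x)) once-y))
  ... | no _     | yes refl =
    inj₂ (cong (y ∷_) (trans (restrict-sym x y w) (trans (restrict-absent x w (∷-injectiveʳ once-y)) once-x)))
  ... | no _     | no _     = restrict-arrangement w x≢y once-x once-y

  arrangement-≢-reverse : ∀ {x y r} → x ≢ y → Arrangement x y r → r ≢ reverse r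
  arrangement-≢-reverse x≢y (inj₁ refl) e = x≢y (∷-injectiveˡ e)
  arrangement-≢-reverse x≢y (inj₂ refl) e = x≢y (sym (∷-injectiveˡ e))

  linked-arrangements-++ : ∀ {x y r₁ r₂} → x ≢ y → Arrangement x y r₁ → Arrangement x y r₂ →
                           Linked _≢_ (r₁ ++ r₂) ⇔ r₁ ≡ r₂
  linked-arrangements-++ x≢y (inj₁ refl) (inj₁ refl) =
    mk⇔ (const refl) (const (x≢y ∷ (x≢y ∘ sym) ∷ x≢y ∷ [-]))
  linked-arrangements-++ x≢y (inj₂ refl) (inj₂ refl) =
    mk⇔ (const refl) (const ((x≢y ∘ sym) ∷ x≢y ∷ (x≢y ∘ sym) ∷ [-]))
  linked-arrangements-++ x≢y (inj₁ refl) (inj₂ refl) =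
    mk⇔ (λ { (_ ∷ y≢y ∷ _) → ⊥-elim (y≢y refl) }) (λ e → ⊥-elim (x≢y (∷-injectiveˡ e)))
  linked-arrangements-++ x≢y (inj₂ refl) (inj₁ refl) =
    mk⇔ (λ { (_ ∷ x≢x ∷ _) → ⊥-elim (x≢x refl) }) (λ e → ⊥-elim (x≢y (sym (∷-injectiveˡ e))))

  permutations-realise : ∀ {σ₁ σ₂ E} → IsPermutation σ₁ → IsPermutation σ₂ →
                         PermutationsRealise σ₁ σ₂ E → Realises (σ₁ ++ σ₂) E
  permutations-realise {σ₁} {σ₂} {E} perm₁ perm₂ realise x y x≢y = begin
    Alternate x y (σ₁ ++ σ₂)
      ≡⟨ cong (Linked _≢_) (filter-++ _ σ₁ σ₂) ⟩
    Linked _≢_ (restrict x y σ₁ ++ restrict x y σ₂)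
      ∼⟨ linked-arrangements-++ x≢y (order σ₁ perm₁) (order σ₂ perm₂) ⟩
    restrict x y σ₁ ≡ restrict x y σ₂
      ∼⟨ realise x y x≢y ⟩
    T (E x y) ∎
    where
    open EquationalReasoning
    order : ∀ σ → IsPermutation σ → Arrangement x y (restrict x y σ)
    order σ perm = restrict-arrangement σ x≢y (perm x) (perm y)

  occursOnce-deduplicate : ∀ {x w} → x ∈ w → OccursOnce x (deduplicate _≟_ w)
  occursOnce-deduplicate {x} {w} x∈w with ys , occurrences≡ ← occurrences-∈ x∈w = begin
    occurrences x (deduplicate _≟_ w)              ≡⟨ filter-deduplicate (_≟ x) _≟_ w ⟩
    deduplicate _≟_ (occurrences x w)              ≡⟨ cong (deduplicate _≟_) occurrences≡ ⟩
    x ∷ filter (¬? ∘ (x ≟_)) (deduplicate _≟_ ys)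
      ≡⟨ cong (x ∷_) (filter-none _ (deduplicate⁺ _≟_ only-x)) ⟩
    x ∷ []                                         ∎
    where
    open ≡-Reasoning
    only-x : All (λ z → ¬ ¬ x ≡ z) ys
    only-x = All.map (λ z≡x x≢z → x≢z (sym z≡x))
                     (All.tail (subst (All (_≡ x)) occurrences≡ (all-filter (_≟ x) w)))

  linked-arrangement-∷ : ∀ {x y c s} r → x ≢ y → Arrangement x y (c ∷ s) →
                         Linked _≢_ ((c ∷ s) ++ c ∷ r) ⇔ Linked _≢_ (c ∷ r)
  linked-arrangement-∷ r x≢y (inj₁ refl) =
    mk⇔ (Linked.tail ∘ Linked.tail) (λ l → x≢y ∷ (x≢y ∘ sym) ∷ l)
  linked-arrangement-∷ r x≢y (inj₂ refl) =
    mk⇔ (Linked.tail ∘ Linked.tail) (λ l → (x≢y ∘ sym) ∷ x≢y ∷ l)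

  -- restrict x y (deduplicate w) is an arrangement c c' of x and y whose first letter c is that of
  -- restrict x y w, so the prefix turns c ... into c c' c ..., which alternates iff c ... does.
  alternate-deduplicate-++ : ∀ {x y w} → x ≢ y → x ∈ w → y ∈ w →
                             Alternate x y (deduplicate _≟_ w ++ w) ⇔ Alternate x y w
  alternate-deduplicate-++ {x} {y} {w} x≢y x∈w y∈w with c , r , restrict≡ ← restrict-∈ y x∈w =
    subst₂ (λ u v → Linked _≢_ u ⇔ Linked _≢_ v) (sym word≡) (sym restrict≡)
           (linked-arrangement-∷ r x≢y arrangement)
    where
    s : List A
    s = filter (¬? ∘ (c ≟_)) (deduplicate _≟_ r)
    prefix≡ : restrict x y (deduplicate _≟_ w) ≡ c ∷ s
    prefix≡ = trans (filter-deduplicate _ _≟_ w) (cong (deduplicate _≟_) restrict≡)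
    arrangement : Arrangement x y (c ∷ s)
    arrangement = subst (Arrangement x y) prefix≡
      (restrict-arrangement (deduplicate _≟_ w) x≢y (occursOnce-deduplicate x∈w) (occursOnce-deduplicate y∈w))
    word≡ : restrict x y (deduplicate _≟_ w ++ w) ≡ (c ∷ s) ++ c ∷ r
    word≡ = trans (filter-++ _ (deduplicate _≟_ w) w) (cong₂ _++_ prefix≡ restrict≡)

module WordMaps {A B : Set} (_≟A_ : DecidableEquality A) (_≟B_ : DecidableEquality B)
                {f : A → B} (f-injective : Injective _≡_ _≡_ f) where
  private
    module WA = Words _≟A_
    module WB = Words _≟B_

  restrict-map : ∀ x y w → WB.restrict (f x) (f y) (map f w) ≡ map f (WA.restrict x y w)
  restrict-map x y w = trans (filter-map _ f w)
    (cong (map f) (filter-≐ _ _ (Sum.map f-injective f-injective , Sum.map (cong f) (cong f)) w))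

  occurrences-map : ∀ x w → WB.occurrences (f x) (map f w) ≡ map f (WA.occurrences x w)
  occurrences-map x w = trans (filter-map _ f w) (cong (map f) (filter-≐ _ _ (f-injective , cong f) w))

  alternate-map : ∀ x y w → WB.Alternate (f x) (f y) (map f w) ⇔ WA.Alternate x y w
  alternate-map x y w = subst (λ v → Linked _≢_ v ⇔ WA.Alternate x y w) (sym (restrict-map x y w))
                              (linked-map-injective f-injective _)

  realises-map : ∀ {w E} (g : B → A) → (∀ b → f (g b) ≡ b) →
                 WA.Realises w E → WB.Realises (map f w) (λ i j → E (g i) (g j))
  realises-map {w} {E} g f∘g realise i j i≢j = begin
    WB.Alternate i j (map f w)
      ≡⟨ cong₂ (λ u v → WB.Alternate u v (map f w)) (sym (f∘g i)) (sym (f∘g j)) ⟩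
    WB.Alternate (f (g i)) (f (g j)) (map f w)  ∼⟨ alternate-map (g i) (g j) w ⟩
    WA.Alternate (g i) (g j) w                  ∼⟨ realise (g i) (g j) gi≢gj ⟩
    T (E (g i) (g j))                           ∎
    where
    open EquationalReasoning
    gi≢gj : g i ≢ g j
    gi≢gj gi≡gj = i≢j (trans (sym (f∘g i)) (trans (cong f gi≡gj) (f∘g j)))

module Lexicographic {A B : Set} (_≟A_ : DecidableEquality A) (_≟B_ : DecidableEquality B) where
  private
    module WA = Words _≟A_
    module WB = Words _≟B_
    module Fibre (a : A) = WordMaps _≟B_ (≡-dec _≟A_ _≟B_) {a ,_} (cong proj₂)
  open Words (≡-dec _≟A_ _≟B_) public

  lexᵇ : (A → A → Bool) → (B → B → Bool) → A × B → A × B → Bool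
  lexᵇ E F (a , x) (a' , y) = if does (a ≟A a') then F x y else E a a'

  lexWord : List A → List B → List B → List (A × B)
  lexWord w σ₁ σ₂ = cartesianProduct (deduplicate _≟A_ w) σ₁ ++ cartesianProduct w σ₂

  lexWord-covers : ∀ {w σ₁ σ₂} → (∀ a → a ∈ w) → (∀ x → x ∈ σ₂) →
                   ∀ p → p ∈ lexWord w σ₁ σ₂
  lexWord-covers {w} {σ₁} covers covers₂ (a , x) =
    ∈-++⁺ʳ (cartesianProduct (deduplicate _≟A_ w) σ₁) (∈-cartesianProduct⁺ (covers a) (covers₂ x))

  restrict-fibre-outside : ∀ {a a' t} x y σ → t ≢ a → t ≢ a' →
                           restrict (a , x) (a' , y) (map (t ,_) σ) ≡ []
  restrict-fibre-outside x y σ t≢a t≢a' = trans (filter-map _ _ σ)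
    (cong (map _) (filter-none _ (All.universal (λ _ → Sum.[ t≢a ∘ cong proj₁ , t≢a' ∘ cong proj₁ ]) σ)))

  restrict-fibre-first : ∀ {a a'} x y σ → a ≢ a' →
                         restrict (a , x) (a' , y) (map (a ,_) σ) ≡ map (a ,_) (WB.occurrences x σ)
  restrict-fibre-first {a} {a'} x y σ a≢a' =
    trans (filter-map _ _ σ) (cong (map _) (filter-≐ _ _ (first , λ { refl → inj₁ refl }) σ))
    where
    first : ∀ {b} → (a , b) ≡ (a , x) ⊎ (a , b) ≡ (a' , y) → b ≡ x
    first (inj₁ refl) = refl
    first (inj₂ e)    = ⊥-elim (a≢a' (cong proj₁ e))

  restrict-fibre-second : ∀ {a a'} x y σ → a ≢ a' →
                          restrict (a , x) (a' , y) (map (a' ,_) σ) ≡ map (a' ,_) (WB.occurrences y σ)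
  restrict-fibre-second {a} {a'} x y σ a≢a' =
    trans (restrict-sym (a , x) (a' , y) (map (a' ,_) σ)) (restrict-fibre-first y x σ (a≢a' ∘ sym))

  restrict-cartesianProduct-same : ∀ a x y σ w → restrict (a , x) (a , y) (cartesianProduct w σ) ≡
                                                 cartesianProduct (WA.occurrences a w) (WB.restrict x y σ)
  restrict-cartesianProduct-same a x y σ [] = refl
  restrict-cartesianProduct-same a x y σ (t ∷ w) with t ≟A a
  ... | yes refl = trans (filter-++ _ (map (a ,_) σ) (cartesianProduct w σ))
    (cong₂ _++_ (Fibre.restrict-map a x y σ) (restrict-cartesianProduct-same a x y σ w))
  ... | no t≢a   = trans (filter-++ _ (map (t ,_) σ) (cartesianProduct w σ))
    (cong₂ _++_ (restrict-fibre-outside x y σ t≢a t≢a) (restrict-cartesianProduct-same a x y σ w))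

  over : A → B → B → A → A × B
  over a x y t = t , (if does (t ≟A a) then x else y)

  over-first : ∀ a x y → over a x y a ≡ (a , x)
  over-first a x y = cong (λ b → a , (if b then x else y)) (dec-true (a ≟A a) refl)

  over-second : ∀ {a a'} x y → a' ≢ a → over a x y a' ≡ (a' , y)
  over-second {a} {a'} x y a'≢a = cong (λ b → a' , (if b then x else y)) (dec-false (a' ≟A a) a'≢a)

  restrict-cartesianProduct-apart : ∀ {a a' x y σ} → a ≢ a' → WB.OccursOnce x σ → WB.OccursOnce y σ →
                                    ∀ w → restrict (a , x) (a' , y) (cartesianProduct w σ) ≡
                                    map (over a x y) (WA.restrict a a' w)
  restrict-cartesianProduct-apart _ _ _ [] = refl
  restrict-cartesianProduct-apart {a} {a'} {x} {y} {σ} a≢a' once-x once-y (t ∷ w)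
    with t ≟A a | t ≟A a' | restrict-cartesianProduct-apart a≢a' once-x once-y w
  ... | yes refl | yes refl | _  = ⊥-elim (a≢a' refl)
  ... | yes refl | no _     | ih = trans (filter-++ _ (map (a ,_) σ) (cartesianProduct w σ))
    (cong₂ _++_ (trans (restrict-fibre-first x y σ a≢a')
                       (trans (cong (map (a ,_)) once-x) (cong [_] (sym (over-first a x y))))) ih)
  ... | no a'≢a  | yes refl | ih = trans (filter-++ _ (map (a' ,_) σ) (cartesianProduct w σ))
    (cong₂ _++_ (trans (restrict-fibre-second x y σ a≢a')
                       (trans (cong (map (a' ,_)) once-y) (cong [_] (sym (over-second x y a'≢a))))) ih)
  ... | no t≢a   | no t≢a'  | ih = trans (filter-++ _ (map (t ,_) σ) (cartesianProduct w σ))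
    (cong₂ _++_ (restrict-fibre-outside x y σ t≢a t≢a') ih)

  restrict-cartesianProduct-++-apart :
    ∀ {a a' x y σ₁ σ₂} → a ≢ a' →
    WB.OccursOnce x σ₁ → WB.OccursOnce y σ₁ → WB.OccursOnce x σ₂ → WB.OccursOnce y σ₂ → ∀ u v →
    restrict (a , x) (a' , y) (cartesianProduct u σ₁ ++ cartesianProduct v σ₂) ≡
    map (over a x y) (WA.restrict a a' (u ++ v))
  restrict-cartesianProduct-++-apart {a} {a'} {x} {y} {σ₁} {σ₂} a≢a' once-x₁ once-y₁ once-x₂ once-y₂ u v =
    begin
    restrict (a , x) (a' , y) (cartesianProduct u σ₁ ++ cartesianProduct v σ₂)
      ≡⟨ filter-++ _ (cartesianProduct u σ₁) (cartesianProduct v σ₂) ⟩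
    restrict (a , x) (a' , y) (cartesianProduct u σ₁) ++ restrict (a , x) (a' , y) (cartesianProduct v σ₂)
      ≡⟨ cong₂ _++_ (restrict-cartesianProduct-apart a≢a' once-x₁ once-y₁ u)
                    (restrict-cartesianProduct-apart a≢a' once-x₂ once-y₂ v) ⟩
    map (over a x y) (WA.restrict a a' u) ++ map (over a x y) (WA.restrict a a' v)
      ≡⟨ map-++ (over a x y) (WA.restrict a a' u) (WA.restrict a a' v) ⟨
    map (over a x y) (WA.restrict a a' u ++ WA.restrict a a' v)
      ≡⟨ cong (map (over a x y)) (filter-++ _ u v) ⟨
    map (over a x y) (WA.restrict a a' (u ++ v)) ∎
    where open ≡-Reasoning

  linked-cartesianProduct-pair : ∀ {x y : B} → x ≢ y → (ts : List A) →
                                 Linked _≢_ (cartesianProduct ts (x ∷ y ∷ []))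
  linked-cartesianProduct-pair x≢y []           = []
  linked-cartesianProduct-pair x≢y (_ ∷ [])     = (x≢y ∘ cong proj₂) ∷ [-]
  linked-cartesianProduct-pair x≢y (_ ∷ t ∷ ts) =
    (x≢y ∘ cong proj₂) ∷ (x≢y ∘ sym ∘ cong proj₂) ∷ linked-cartesianProduct-pair x≢y (t ∷ ts)

  linked-cartesianProduct-arrangements :
    ∀ {x y r₁ r₂} → x ≢ y → WB.Arrangement x y r₁ → WB.Arrangement x y r₂ → (a : A) (ts : List A) →
    Linked _≢_ (cartesianProduct [ a ] r₁ ++ cartesianProduct (a ∷ ts) r₂) ⇔ r₁ ≡ r₂
  linked-cartesianProduct-arrangements x≢y (inj₁ refl) (inj₁ refl) a ts =
    mk⇔ (const refl) (const (linked-cartesianProduct-pair x≢y (a ∷ a ∷ ts)))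
  linked-cartesianProduct-arrangements x≢y (inj₂ refl) (inj₂ refl) a ts =
    mk⇔ (const refl) (const (linked-cartesianProduct-pair (x≢y ∘ sym) (a ∷ a ∷ ts)))
  linked-cartesianProduct-arrangements x≢y (inj₁ refl) (inj₂ refl) a ts =
    mk⇔ (λ { (_ ∷ y≢y ∷ _) → ⊥-elim (y≢y refl) }) (λ e → ⊥-elim (x≢y (∷-injectiveˡ e)))
  linked-cartesianProduct-arrangements x≢y (inj₂ refl) (inj₁ refl) a ts =
    mk⇔ (λ { (_ ∷ x≢x ∷ _) → ⊥-elim (x≢x refl) }) (λ e → ⊥-elim (x≢y (sym (∷-injectiveˡ e))))

  -- Over a single a, the letters x and y occur once in the σ₁-block and then in σ₂-blocks, so they
  -- alternate iff σ₁ and σ₂ order them alike; over a ≢ a' they alternate iff a and a' do in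
  -- deduplicate w ++ w, that is, in w.
  lexWord-realises : ∀ {w σ₁ σ₂ E F} → (∀ a → a ∈ w) → WA.Realises w E →
                     WB.IsPermutation σ₁ → WB.IsPermutation σ₂ → WB.PermutationsRealise σ₁ σ₂ F →
                     Realises (lexWord w σ₁ σ₂) (lexᵇ E F)
  lexWord-realises {w} {σ₁} {σ₂} {E} {F} covers realise perm₁ perm₂ realise-perms (a , x) (a' , y) p≢q
    with a ≟A a'
  ... | yes refl with ts , occurrences≡ ← WA.occurrences-∈ (covers a) = begin
    Alternate (a , x) (a , y) (lexWord w σ₁ σ₂)
      ≡⟨ cong (Linked _≢_) (filter-++ _ (cartesianProduct (deduplicate _≟A_ w) σ₁) _) ⟩
    Linked _≢_ (restrict (a , x) (a , y) (cartesianProduct (deduplicate _≟A_ w) σ₁) ++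
                restrict (a , x) (a , y) (cartesianProduct w σ₂))
      ≡⟨ cong (Linked _≢_) (cong₂ _++_ first-block other-blocks) ⟩
    Linked _≢_ (cartesianProduct [ a ] r₁ ++ cartesianProduct (a ∷ ts) r₂)
      ∼⟨ linked-cartesianProduct-arrangements x≢y (WB.restrict-arrangement σ₁ x≢y (perm₁ x) (perm₁ y))
                                                  (WB.restrict-arrangement σ₂ x≢y (perm₂ x) (perm₂ y)) a ts ⟩
    r₁ ≡ r₂
      ∼⟨ realise-perms x y x≢y ⟩
    T (F x y) ∎
    where
    open EquationalReasoning
    x≢y : x ≢ y
    x≢y x≡y = p≢q (cong (a ,_) x≡y)
    r₁ r₂ : List B
    r₁ = WB.restrict x y σ₁
    r₂ = WB.restrict x y σ₂
    first-block : restrict (a , x) (a , y) (cartesianProduct (deduplicate _≟A_ w) σ₁) ≡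
                  cartesianProduct [ a ] r₁
    first-block = trans (restrict-cartesianProduct-same a x y σ₁ (deduplicate _≟A_ w))
                        (cong (λ ts → cartesianProduct ts r₁) (WA.occursOnce-deduplicate (covers a)))
    other-blocks : restrict (a , x) (a , y) (cartesianProduct w σ₂) ≡ cartesianProduct (a ∷ ts) r₂
    other-blocks = trans (restrict-cartesianProduct-same a x y σ₂ w)
                         (cong (λ ts → cartesianProduct ts r₂) occurrences≡)
  ... | no a≢a' = begin
    Alternate (a , x) (a' , y) (lexWord w σ₁ σ₂)
      ≡⟨ cong (Linked _≢_) (restrict-cartesianProduct-++-apart a≢a' (perm₁ x) (perm₁ y) (perm₂ x) (perm₂ y)
                                                               (deduplicate _≟A_ w) w) ⟩
    Linked _≢_ (map (over a x y) (WA.restrict a a' (deduplicate _≟A_ w ++ w)))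
      ∼⟨ linked-map-injective (cong proj₁) _ ⟩
    WA.Alternate a a' (deduplicate _≟A_ w ++ w)
      ∼⟨ WA.alternate-deduplicate-++ a≢a' (covers a) (covers a') ⟩
    WA.Alternate a a' w
      ∼⟨ realise a a' a≢a' ⟩
    T (E a a') ∎
    where open EquationalReasoning

  restrict-cartesianProduct-split :
    ∀ p p' σ us a vs →
    restrict p p' (cartesianProduct (us ++ a ∷ vs) σ) ≡
    restrict p p' (cartesianProduct us σ) ++ restrict p p' (map (a ,_) σ) ++
    restrict p p' (cartesianProduct vs σ)
  restrict-cartesianProduct-split p p' σ us a vs = begin
    restrict p p' (cartesianProduct (us ++ a ∷ vs) σ)
      ≡⟨ cong (restrict p p') (cartesianProductWith-distribʳ-++ _,_ us (a ∷ vs) σ) ⟩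
    restrict p p' (cartesianProduct us σ ++ map (a ,_) σ ++ cartesianProduct vs σ)
      ≡⟨ filter-++ _ (cartesianProduct us σ) _ ⟩
    restrict p p' (cartesianProduct us σ) ++ restrict p p' (map (a ,_) σ ++ cartesianProduct vs σ)
      ≡⟨ cong (restrict p p' (cartesianProduct us σ) ++_) (filter-++ _ (map (a ,_) σ) (cartesianProduct vs σ)) ⟩
    restrict p p' (cartesianProduct us σ) ++ restrict p p' (map (a ,_) σ) ++
    restrict p p' (cartesianProduct vs σ) ∎
    where open ≡-Reasoning

  ¬alternate-cartesianProduct-repeated : ∀ {a a' x y σ e ys} → a ≢ a' → a ∈ e →
                                         WB.occurrences x σ ≡ x ∷ x ∷ ys →
                                         ¬ Alternate (a , x) (a' , y) (cartesianProduct e σ)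
  ¬alternate-cartesianProduct-repeated {a} {a'} {x} {y} {σ} {ys = ys} a≢a' a∈e twice alternate
    with us , vs , refl ← ∈-∃++ a∈e =
    ¬linked-repeat (before us) _ (subst (Linked _≢_) word≡ alternate)
    where
    before : List A → List (A × B)
    before us = restrict (a , x) (a' , y) (cartesianProduct us σ)
    word≡ : restrict (a , x) (a' , y) (cartesianProduct (us ++ a ∷ vs) σ) ≡
            before us ++ map (a ,_) (x ∷ x ∷ ys) ++ before vs
    word≡ = trans (restrict-cartesianProduct-split (a , x) (a' , y) σ us a vs)
                  (cong (λ m → before us ++ m ++ before vs)
                        (trans (restrict-fibre-first x y σ a≢a') (cong (map (a ,_)) twice)))

  cartesianProduct-realises : ∀ {e w F} → WA.IsPermutation e → (∀ x → x ∈ w) → WB.Realises w F →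
                              Realises (cartesianProduct e (deduplicate _≟B_ w ++ w)) (lexᵇ (λ _ _ → false) F)
  cartesianProduct-realises {e} {w} {F} perm covers realise (a , x) (a' , y) p≢q with a ≟A a'
  ... | yes refl = begin
    Alternate (a , x) (a , y) (cartesianProduct e q)
      ≡⟨ cong (Linked _≢_) (trans (restrict-cartesianProduct-same a x y q e)
                                  (cong (λ ts → cartesianProduct ts (WB.restrict x y q)) (perm a))) ⟩
    Linked _≢_ (map (a ,_) (WB.restrict x y q) ++ [])
      ≡⟨ cong (Linked _≢_) (++-identityʳ _) ⟩
    Linked _≢_ (map (a ,_) (WB.restrict x y q))
      ∼⟨ linked-map-injective (cong proj₂) _ ⟩
    WB.Alternate x y q
      ∼⟨ WB.alternate-deduplicate-++ x≢y (covers x) (covers y) ⟩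
    WB.Alternate x y w
      ∼⟨ realise x y x≢y ⟩
    T (F x y) ∎
    where
    open EquationalReasoning
    q : List B
    q = deduplicate _≟B_ w ++ w
    x≢y : x ≢ y
    x≢y x≡y = p≢q (cong (a ,_) x≡y)
  ... | no a≢a' with ys , occurrences≡ ← WB.occurrences-∈ (covers x) =
    mk⇔ (⊥-elim ∘ ¬alternate-cartesianProduct-repeated {y = y} {e = e} a≢a' (WA.occursOnce⇒∈ (perm a)) twice)
        λ ()
    where
    twice : WB.occurrences x (deduplicate _≟B_ w ++ w) ≡ x ∷ x ∷ ys
    twice = trans (filter-++ _ (deduplicate _≟B_ w) w)
                  (cong₂ _++_ (WB.occursOnce-deduplicate (covers x)) occurrences≡)

module _ {k : ℕ} where
  private
    module W = Words (_≟ᶠ_ {k})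
    module Suc = WordMaps (_≟ᶠ_ {k}) (_≟ᶠ_ {suc k}) suc-injective
  open Words (_≟ᶠ_ {suc k})

  addIsolated : (Fin k → Fin k → Bool) → Fin (suc k) → Fin (suc k) → Bool
  addIsolated E (suc u) (suc v) = E u v
  addIsolated E _       _       = false

  star : (Fin k → Bool) → Fin (suc k) → Fin (suc k) → Bool
  star leaf zero    (suc v) = leaf v
  star leaf (suc u) zero    = leaf u
  star leaf _       _       = false

  adj≡addIsolated∨star : (G : Graph (suc k)) → ∀ x y →
                         adj G x y ≡ addIsolated (adj (induce G suc)) x y ∨ star (adj G zero ∘ suc) x y
  adj≡addIsolated∨star G zero    zero    = adj-irrefl G zero
  adj≡addIsolated∨star G zero    (suc v) = refl
  adj≡addIsolated∨star G (suc u) zero    = adj-sym G (suc u) zero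
  adj≡addIsolated∨star G (suc u) (suc v) = sym (∨-identityʳ _)

  isolatedWord : List (Fin k) → List (Fin (suc k))
  isolatedWord w = zero ∷ zero ∷ map suc w

  isolatedWord-covers : ∀ {w} → (∀ v → v ∈ w) → ∀ v → v ∈ isolatedWord w
  isolatedWord-covers covers zero    = here refl
  isolatedWord-covers covers (suc v) = there (there (∈-map⁺ suc (covers v)))

  isolatedWord-realises : ∀ {w E} → W.Realises w E → Realises (isolatedWord w) (addIsolated E)
  isolatedWord-realises realise zero    _       _ = mk⇔ (λ { (0≢0 ∷ _) → ⊥-elim (0≢0 refl) }) λ ()
  isolatedWord-realises realise (suc u) zero    _ = mk⇔ (λ { (0≢0 ∷ _) → ⊥-elim (0≢0 refl) }) λ ()
  isolatedWord-realises {w} {E} realise (suc u) (suc v) u≢v = begin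
    Alternate (suc u) (suc v) (map suc w)  ∼⟨ Suc.alternate-map u v w ⟩
    W.Alternate u v w                      ∼⟨ realise u v (u≢v ∘ cong suc) ⟩
    T (addIsolated E (suc u) (suc v))      ∎
    where open EquationalReasoning

  occurrences-zero-map-suc : ∀ w → occurrences zero (map suc w) ≡ []
  occurrences-zero-map-suc []      = refl
  occurrences-zero-map-suc (_ ∷ w) = occurrences-zero-map-suc w

  restrict-zero-map-suc : ∀ v w → restrict zero (suc v) (map suc w) ≡ map suc (W.occurrences v w)
  restrict-zero-map-suc v w = trans (filter-map _ suc w)
    (cong (map suc) (filter-≐ _ _ ((λ { (inj₂ refl) → refl }) , λ { refl → inj₂ refl }) w))

allFin-isPermutation : ∀ n → Words.IsPermutation _≟ᶠ_ (allFin n)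
allFin-isPermutation (suc n) zero = cong (zero ∷_) (begin
  occurrences zero (tabulate suc)        ≡⟨ cong (occurrences zero) (map-tabulate id suc) ⟨
  occurrences zero (map suc (allFin n))  ≡⟨ occurrences-zero-map-suc (allFin n) ⟩
  []                                     ∎)
  where open ≡-Reasoning; open Words (_≟ᶠ_ {suc n})
allFin-isPermutation (suc n) (suc v) = begin
  occurrences (suc v) (tabulate suc)             ≡⟨ cong (occurrences (suc v)) (map-tabulate id suc) ⟨
  occurrences (suc v) (map suc (allFin n))
    ≡⟨ WordMaps.occurrences-map _≟ᶠ_ _≟ᶠ_ suc-injective v (allFin n) ⟩
  map suc (Words.occurrences _≟ᶠ_ v (allFin n))  ≡⟨ cong (map suc) (allFin-isPermutation n v) ⟩
  [ suc v ]                                      ∎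
  where open ≡-Reasoning; open Words (_≟ᶠ_ {suc n})

module StarPermutations {k : ℕ} (leaf : Fin k → Bool) where
  private
    module W = Words (_≟ᶠ_ {k})
    module Suc = WordMaps (_≟ᶠ_ {k}) (_≟ᶠ_ {suc k}) suc-injective
  open Words (_≟ᶠ_ {suc k})
  open ≡-Reasoning

  leaves others : List (Fin k)
  leaves = filterᵇ leaf (allFin k)
  others = filterᵇ (not ∘ leaf) (allFin k)

  starPerm₁ starPerm₂ : List (Fin (suc k))
  starPerm₁ = zero ∷ map suc (leaves ++ others)
  starPerm₂ = reverse (map suc leaves ++ zero ∷ map suc others)

  occurrences-leaves : ∀ v → W.occurrences v leaves ≡ filterᵇ leaf [ v ]
  occurrences-leaves v = trans (filter-comm _ _ (allFin k)) (cong (filterᵇ leaf) (allFin-isPermutation k v))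

  occurrences-others : ∀ v → W.occurrences v others ≡ filterᵇ (not ∘ leaf) [ v ]
  occurrences-others v =
    trans (filter-comm _ _ (allFin k)) (cong (filterᵇ (not ∘ leaf)) (allFin-isPermutation k v))

  leaves-others-isPermutation : W.IsPermutation (leaves ++ others)
  leaves-others-isPermutation v = begin
    W.occurrences v (leaves ++ others)                ≡⟨ filter-++ _ leaves others ⟩
    W.occurrences v leaves ++ W.occurrences v others  ≡⟨ cong₂ _++_ (occurrences-leaves v) (occurrences-others v) ⟩
    filterᵇ leaf [ v ] ++ filterᵇ (not ∘ leaf) [ v ]  ≡⟨ leaf-or-other ⟩
    [ v ]                                             ∎
    where
    leaf-or-other : filterᵇ leaf [ v ] ++ filterᵇ (not ∘ leaf) [ v ] ≡ [ v ]
    leaf-or-other with leaf v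
    ... | true  = refl
    ... | false = refl

  starPerm₁-isPermutation : IsPermutation starPerm₁
  starPerm₁-isPermutation zero    = cong (zero ∷_) (occurrences-zero-map-suc (leaves ++ others))
  starPerm₁-isPermutation (suc v) =
    trans (Suc.occurrences-map v (leaves ++ others)) (cong (map suc) (leaves-others-isPermutation v))

  filter-starPerm₂ : ∀ {P : Pred (Fin (suc k)) ℓ} (P? : Decidable P) → ¬ P zero →
                     filter P? starPerm₂ ≡ reverse (filter P? (map suc (leaves ++ others)))
  filter-starPerm₂ P? ¬P0 = begin
    filter P? (reverse (map suc leaves ++ zero ∷ map suc others))
      ≡⟨ filter-reverse P? (map suc leaves ++ zero ∷ map suc others) ⟩
    reverse (filter P? (map suc leaves ++ zero ∷ map suc others))
      ≡⟨ cong reverse (filter-++ P? (map suc leaves) (zero ∷ map suc others)) ⟩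
    reverse (filter P? (map suc leaves) ++ filter P? (zero ∷ map suc others))
      ≡⟨ cong (λ o → reverse (filter P? (map suc leaves) ++ o)) (filter-reject P? ¬P0) ⟩
    reverse (filter P? (map suc leaves) ++ filter P? (map suc others))
      ≡⟨ cong reverse (filter-++ P? (map suc leaves) (map suc others)) ⟨
    reverse (filter P? (map suc leaves ++ map suc others))
      ≡⟨ cong (reverse ∘ filter P?) (map-++ suc leaves others) ⟨
    reverse (filter P? (map suc (leaves ++ others))) ∎

  starPerm₂-isPermutation : IsPermutation starPerm₂
  starPerm₂-isPermutation zero = begin
    occurrences zero starPerm₂
      ≡⟨ filter-reverse _ (map suc leaves ++ zero ∷ map suc others) ⟩
    reverse (occurrences zero (map suc leaves ++ zero ∷ map suc others))
      ≡⟨ cong reverse (filter-++ _ (map suc leaves) (zero ∷ map suc others)) ⟩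
    reverse (occurrences zero (map suc leaves) ++ zero ∷ occurrences zero (map suc others))
      ≡⟨ cong₂ (λ u w → reverse (u ++ zero ∷ w))
               (occurrences-zero-map-suc leaves) (occurrences-zero-map-suc others) ⟩
    [ zero ] ∎
  starPerm₂-isPermutation (suc v) =
    trans (filter-starPerm₂ _ λ ()) (cong reverse (starPerm₁-isPermutation (suc v)))

  starPerm₁-covers : ∀ v → v ∈ starPerm₁
  starPerm₁-covers v = occursOnce⇒∈ (starPerm₁-isPermutation v)

  starPerm₂-covers : ∀ v → v ∈ starPerm₂
  starPerm₂-covers v = occursOnce⇒∈ (starPerm₂-isPermutation v)

  restrict-starPerm₁-centre : ∀ v → restrict zero (suc v) starPerm₁ ≡ zero ∷ suc v ∷ []
  restrict-starPerm₁-centre v = cong (zero ∷_)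
    (trans (restrict-zero-map-suc v (leaves ++ others)) (cong (map suc) (leaves-others-isPermutation v)))

  restrict-starPerm₂-centre : ∀ v → restrict zero (suc v) starPerm₂ ≡
                              reverse (map suc (filterᵇ leaf [ v ]) ++ zero ∷ map suc (filterᵇ (not ∘ leaf) [ v ]))
  restrict-starPerm₂-centre v = begin
    restrict zero (suc v) starPerm₂
      ≡⟨ filter-reverse _ (map suc leaves ++ zero ∷ map suc others) ⟩
    reverse (restrict zero (suc v) (map suc leaves ++ zero ∷ map suc others))
      ≡⟨ cong reverse (filter-++ _ (map suc leaves) (zero ∷ map suc others)) ⟩
    reverse (restrict zero (suc v) (map suc leaves) ++ zero ∷ restrict zero (suc v) (map suc others))
      ≡⟨ cong₂ (λ u w → reverse (u ++ zero ∷ w))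
               (trans (restrict-zero-map-suc v leaves) (cong (map suc) (occurrences-leaves v)))
               (trans (restrict-zero-map-suc v others) (cong (map suc) (occurrences-others v))) ⟩
    reverse (map suc (filterᵇ leaf [ v ]) ++ zero ∷ map suc (filterᵇ (not ∘ leaf) [ v ])) ∎

  same-order-centre : ∀ v → (zero ∷ suc v ∷ [] ≡
                             reverse (map suc (filterᵇ leaf [ v ]) ++ zero ∷ map suc (filterᵇ (not ∘ leaf) [ v ])))
                            ⇔ T (leaf v)
  same-order-centre v with leaf v
  ... | true  = mk⇔ (const tt) (const refl)
  ... | false = mk⇔ (λ ()) (λ ())

  -- A leaf follows zero in both permutations, any other vertex precedes zero in exactly one of them, and
  -- the vertices other than zero appear in opposite orders.
  starPerms-realise : PermutationsRealise starPerm₁ starPerm₂ (star leaf)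
  starPerms-realise zero    zero    0≢0 = ⊥-elim (0≢0 refl)
  starPerms-realise zero    (suc v) _   =
    subst₂ (λ r₁ r₂ → r₁ ≡ r₂ ⇔ T (leaf v))
           (sym (restrict-starPerm₁-centre v)) (sym (restrict-starPerm₂-centre v)) (same-order-centre v)
  starPerms-realise (suc u) zero    u≢0 =
    subst₂ (λ r₁ r₂ → r₁ ≡ r₂ ⇔ T (leaf u))
           (restrict-sym zero (suc u) starPerm₁) (restrict-sym zero (suc u) starPerm₂)
           (starPerms-realise zero (suc u) (u≢0 ∘ sym))
  starPerms-realise (suc u) (suc v) u≢v =
    mk⇔ (λ r₁≡r₂ → ⊥-elim (not-palindrome (trans r₁≡r₂ reversed))) λ ()
    where
    reversed : restrict (suc u) (suc v) starPerm₂ ≡ reverse (restrict (suc u) (suc v) starPerm₁)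
    reversed = filter-starPerm₂ _ λ { (inj₁ ()) ; (inj₂ ()) }
    not-palindrome : restrict (suc u) (suc v) starPerm₁ ≢ reverse (restrict (suc u) (suc v) starPerm₁)
    not-palindrome = arrangement-≢-reverse u≢v
      (restrict-arrangement starPerm₁ u≢v (starPerm₁-isPermutation (suc u)) (starPerm₁-isPermutation (suc v)))

module _ {n : ℕ} where
  open Words (_≟ᶠ_ {n})

  adjacent? : (w : List (Fin n)) → ∀ x y → Dec (x ≢ y × Alternate x y w)
  adjacent? w x y = ¬? (x ≟ᶠ y) ×-dec Linked.linked? (λ u v → ¬? (u ≟ᶠ v)) (restrict x y w)

  wordGraph : List (Fin n) → Graph n
  wordGraph w = record
    { adj        = λ x y → does (adjacent? w x y)
    ; adj-sym    = λ x y → does-⇔ (mk⇔ flip-pair flip-pair) (adjacent? w x y) (adjacent? w y x)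
    ; adj-irrefl = λ x → dec-false (adjacent? w x x) (λ (x≢x , _) → x≢x refl)
    }
    where
    flip-pair : ∀ {x y} → x ≢ y × Alternate x y w → y ≢ x × Alternate y x w
    flip-pair {x} {y} (x≢y , alternate) = x≢y ∘ sym , subst (Linked _≢_) (restrict-sym x y w) alternate

  wordGraph-adjacent : ∀ w x y → Adjacent (wordGraph w) x y ⇔ (x ≢ y × Alternate x y w)
  wordGraph-adjacent w x y = mk⇔ (witness (adjacent? w x y)) (dec-true (adjacent? w x y))
    where
    witness : ∀ {P : Set} (P? : Dec P) → does P? ≡ true → P
    witness (yes p) _ = p

  wordGraph-represents : ∀ {w} → (∀ v → v ∈ w) → Represents (wordGraph w) w
  wordGraph-represents {w} covers = covers , λ x y x≢y →
    mk⇔ (proj₂ ∘ Equivalence.to (wordGraph-adjacent w x y))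
        (λ alternate → Equivalence.from (wordGraph-adjacent w x y) (x≢y , alternate))

  represents⇒realises : ∀ {G w} → Represents G w → Realises w (adj G)
  represents⇒realises {G} {w} (_ , represents) x y x≢y = begin
    Alternate x y w  ∼⟨ ⇔-sym (represents x y x≢y) ⟩
    Adjacent G x y   ∼⟨ ⇔-sym T-≡ ⟩
    T (adj G x y)    ∎
    where open EquationalReasoning

¬adjacent-self : ∀ {n} (G : Graph n) x → ¬ Adjacent G x x
¬adjacent-self G x adjacent with () ← trans (sym (adj-irrefl G x)) adjacent

wordUnion : ∀ {n k} (H : Graph n) (W : Fin (suc k) → List (Fin n)) → (∀ i v → v ∈ W i) →
            (∀ x y → x ≢ y → Adjacent H x y ⇔ (∃[ i ] Words.Alternate _≟ᶠ_ x y (W i))) →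
            WRUnion H (suc k)
wordUnion {n} H W covers adjacency = record
  { size      = λ _ → n
  ; part      = wordGraph ∘ W
  ; embed     = λ _ → id
  ; embed-inj = λ _ → id
  ; part-wr   = λ i → W i , wordGraph-represents (covers i)
  ; vertices  = λ v → zero , v , refl
  ; edges     = λ u v → mk⇔ (to u v) (from u v)
  }
  where
  to : ∀ u v → Adjacent H u v → ∃[ i ] ∃[ a ] ∃[ b ] (a ≡ u × b ≡ v × Adjacent (wordGraph (W i)) a b)
  to u v adjacent with u ≟ᶠ v
  ... | yes refl = ⊥-elim (¬adjacent-self H u adjacent)
  ... | no u≢v with i , alternate ← Equivalence.to (adjacency u v u≢v) adjacent =
    i , u , v , refl , refl , Equivalence.from (wordGraph-adjacent (W i) u v) (u≢v , alternate)
  from : ∀ u v → ∃[ i ] ∃[ a ] ∃[ b ] (a ≡ u × b ≡ v × Adjacent (wordGraph (W i)) a b) → Adjacent H u v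
  from u v (i , _ , _ , refl , refl , adjacent)
    with u≢v , alternate ← Equivalence.to (wordGraph-adjacent (W i) u v) adjacent =
    Equivalence.from (adjacency u v u≢v) (i , alternate)

T-∨₃ : (b : Fin 3 → Bool) → T (b zero ∨ b (suc zero) ∨ b (suc (suc zero))) ⇔ (∃[ i ] T (b i))
T-∨₃ b = mk⇔ to from
  where
  T-∨₀ : T (b zero ∨ b (suc zero) ∨ b (suc (suc zero))) ⇔
         (T (b zero) ⊎ T (b (suc zero) ∨ b (suc (suc zero))))
  T-∨₀ = T-∨
  T-∨₁ : T (b (suc zero) ∨ b (suc (suc zero))) ⇔ (T (b (suc zero)) ⊎ T (b (suc (suc zero))))
  T-∨₁ = T-∨
  to : T (b zero ∨ b (suc zero) ∨ b (suc (suc zero))) → ∃[ i ] T (b i)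
  to t with Equivalence.to T-∨₀ t
  ... | inj₁ t₀ = zero , t₀
  ... | inj₂ t₁₂ with Equivalence.to T-∨₁ t₁₂
  ...   | inj₁ t₁ = suc zero , t₁
  ...   | inj₂ t₂ = suc (suc zero) , t₂
  from : ∃[ i ] T (b i) → T (b zero ∨ b (suc zero) ∨ b (suc (suc zero)))
  from (zero , t₀)           = Equivalence.from T-∨₀ (inj₁ t₀)
  from (suc zero , t₁)       = Equivalence.from T-∨₀ (inj₂ (Equivalence.from T-∨₁ (inj₁ t₁)))
  from (suc (suc zero) , t₂) = Equivalence.from T-∨₀ (inj₂ (Equivalence.from T-∨₁ (inj₂ t₂)))

lexAdj≡lexᵇ : ∀ {n₁ n₂} (G₁ : Graph n₁) (G₂ : Graph n₂) u v x y →
              lexAdj G₁ G₂ u v x y ≡ Lexicographic.lexᵇ _≟ᶠ_ _≟ᶠ_ (adj G₁) (adj G₂) (u , v) (x , y)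
lexAdj≡lexᵇ G₁ G₂ u v x y with u ≟ᶠ x
... | yes _ = refl
... | no _  = refl

graph₀-wordRepresentable : (G : Graph 0) → WordRepresentable G
graph₀-wordRepresentable G = [] , (λ ()) , (λ ())

uncurry-combine-injective : ∀ {m n} → Injective _≡_ _≡_ (uncurry (combine {m} {n}))
uncurry-combine-injective {n = n} {i , j} {i' , j'} e =
  trans (sym (remQuot-combine i j)) (trans (cong (remQuot n) e) (remQuot-combine i' j'))

module LexDecomposition {k₁ k₂ : ℕ} (G₁ : Graph (suc k₁)) (G₂ : Graph (suc k₂)) where
  open Lexicographic (_≟ᶠ_ {suc k₁}) (_≟ᶠ_ {suc k₂})
  private
    module Star₁ = StarPermutations (adj G₁ zero ∘ suc)
    module Star₂ = StarPermutations (adj G₂ zero ∘ suc)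

  part : Fin 3 → Fin (suc k₁) × Fin (suc k₂) → Fin (suc k₁) × Fin (suc k₂) → Bool
  part zero             = lexᵇ (addIsolated (adj (induce G₁ suc))) (star (adj G₂ zero ∘ suc))
  part (suc zero)       = lexᵇ (star (adj G₁ zero ∘ suc)) (star (adj G₂ zero ∘ suc))
  part (suc (suc zero)) = lexᵇ (λ _ _ → false) (addIsolated (adj (induce G₂ suc)))

  lex-decomposition : ∀ p q → lexᵇ (adj G₁) (adj G₂) p q ≡
                              part zero p q ∨ part (suc zero) p q ∨ part (suc (suc zero)) p q
  lex-decomposition (a , x) (a' , y) with does (a ≟ᶠ a')
  ... | true  = trans (adj≡addIsolated∨star G₂ x y) (absorb (addIsolated (adj (induce G₂ suc)) x y)
                                                            (star (adj G₂ zero ∘ suc) x y))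
    where
    absorb : ∀ i s → i ∨ s ≡ s ∨ s ∨ i
    absorb i s = trans (∨-comm i s) (trans (cong (_∨ i) (sym (∨-idem s))) (∨-assoc s s i))
  ... | false = trans (adj≡addIsolated∨star G₁ a a')
                      (cong (addIsolated (adj (induce G₁ suc)) a a' ∨_)
                            (sym (∨-identityʳ (star (adj G₁ zero ∘ suc) a a'))))

  module _ {w₁ w₂} (represents₁ : Represents (induce G₁ suc) w₁)
                   (represents₂ : Represents (induce G₂ suc) w₂) where

    partWord : Fin 3 → List (Fin (suc k₁) × Fin (suc k₂))
    partWord zero             = lexWord (isolatedWord w₁) Star₂.starPerm₁ Star₂.starPerm₂
    partWord (suc zero)       = lexWord (Star₁.starPerm₁ ++ Star₁.starPerm₂) Star₂.starPerm₁ Star₂.starPerm₂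
    partWord (suc (suc zero)) =
      cartesianProduct (allFin (suc k₁)) (deduplicate _≟ᶠ_ (isolatedWord w₂) ++ isolatedWord w₂)

    partWord-covers : ∀ i p → p ∈ partWord i
    partWord-covers zero =
      lexWord-covers {σ₁ = Star₂.starPerm₁} (isolatedWord-covers (proj₁ represents₁)) Star₂.starPerm₂-covers
    partWord-covers (suc zero) =
      lexWord-covers {σ₁ = Star₂.starPerm₁} (∈-++⁺ˡ ∘ Star₁.starPerm₁-covers) Star₂.starPerm₂-covers
    partWord-covers (suc (suc zero)) (a , x) =
      ∈-cartesianProduct⁺ (∈-allFin a)
        (∈-++⁺ʳ (deduplicate _≟ᶠ_ (isolatedWord w₂)) (isolatedWord-covers (proj₁ represents₂) x))

    partWord-realises : ∀ i → Realises (partWord i) (part i)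
    partWord-realises zero =
      lexWord-realises {w = isolatedWord w₁} {Star₂.starPerm₁} {Star₂.starPerm₂}
        (isolatedWord-covers (proj₁ represents₁))
        (isolatedWord-realises (represents⇒realises {G = induce G₁ suc} represents₁))
        Star₂.starPerm₁-isPermutation Star₂.starPerm₂-isPermutation Star₂.starPerms-realise
    partWord-realises (suc zero) =
      lexWord-realises {w = Star₁.starPerm₁ ++ Star₁.starPerm₂} {Star₂.starPerm₁} {Star₂.starPerm₂}
        (∈-++⁺ˡ ∘ Star₁.starPerm₁-covers)
        (Words.permutations-realise _≟ᶠ_ {σ₁ = Star₁.starPerm₁} {σ₂ = Star₁.starPerm₂}
          Star₁.starPerm₁-isPermutation Star₁.starPerm₂-isPermutation Star₁.starPerms-realise)
        Star₂.starPerm₁-isPermutation Star₂.starPerm₂-isPermutation Star₂.starPerms-realise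
    partWord-realises (suc (suc zero)) =
      cartesianProduct-realises {e = allFin (suc k₁)} {w = isolatedWord w₂} (allFin-isPermutation (suc k₁))
        (isolatedWord-covers (proj₁ represents₂))
        (isolatedWord-realises (represents⇒realises {G = induce G₂ suc} represents₂))

lex-wrUnion : ∀ {k₁ k₂} (G₁ : Graph (suc k₁)) (G₂ : Graph (suc k₂)) →
              WordRepresentable (induce G₁ suc) → WordRepresentable (induce G₂ suc) → WRUnion (lex G₁ G₂) 3
lex-wrUnion {k₁} {k₂} G₁ G₂ (w₁ , represents₁) (w₂ , represents₂) =
  wordUnion (lex G₁ G₂) word covers adjacency
  where
  open LexDecomposition G₁ G₂
  open Lexicographic (_≟ᶠ_ {suc k₁}) (_≟ᶠ_ {suc k₂}) using (lexᵇ)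
  open EquationalReasoning
  module Combine = WordMaps (≡-dec _≟ᶠ_ _≟ᶠ_) (_≟ᶠ_ {suc k₁ * suc k₂})
                            (uncurry-combine-injective {suc k₁} {suc k₂})

  split : Fin (suc k₁ * suc k₂) → Fin (suc k₁) × Fin (suc k₂)
  split = remQuot (suc k₂)

  word : Fin 3 → List (Fin (suc k₁ * suc k₂))
  word i = map (uncurry combine) (partWord represents₁ represents₂ i)

  covers : ∀ i v → v ∈ word i
  covers i v = subst (_∈ word i) (combine-remQuot (suc k₂) v)
    (∈-map⁺ (uncurry combine) (partWord-covers represents₁ represents₂ i (split v)))

  adjacency : ∀ x y → x ≢ y → Adjacent (lex G₁ G₂) x y ⇔ (∃[ i ] Words.Alternate _≟ᶠ_ x y (word i))
  adjacency x y x≢y = begin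
    Adjacent (lex G₁ G₂) x y
      ≡⟨ cong (_≡ true) (lexAdj≡lexᵇ G₁ G₂ _ _ _ _) ⟩
    lexᵇ (adj G₁) (adj G₂) (split x) (split y) ≡ true
      ∼⟨ ⇔-sym T-≡ ⟩
    T (lexᵇ (adj G₁) (adj G₂) (split x) (split y))
      ≡⟨ cong T (lex-decomposition (split x) (split y)) ⟩
    T (part zero (split x) (split y) ∨ part (suc zero) (split x) (split y) ∨
       part (suc (suc zero)) (split x) (split y))
      ∼⟨ T-∨₃ (λ i → part i (split x) (split y)) ⟩
    (∃[ i ] T (part i (split x) (split y)))
      ∼⟨ ∃-cong (λ {i} → ⇔-sym (Combine.realises-map {w = partWord represents₁ represents₂ i}
                                   split (combine-remQuot (suc k₂))
                                   (partWord-realises represents₁ represents₂ i) x y x≢y)) ⟩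
    (∃[ i ] Words.Alternate _≟ᶠ_ x y (word i)) ∎

theorem12 : ∀ {n₁ n₂ : _} (G₁ : Graph n₁) (G₂ : Graph n₂) →
    MinimalNonWR G₁ → MinimalNonWR G₂ → μ≤ (lex G₁ G₂) 3
theorem12 {zero}            G₁ G₂ (¬wr₁ , _) _ = ⊥-elim (¬wr₁ (graph₀-wordRepresentable G₁))
theorem12 {suc _} {zero}    G₁ G₂ _ (¬wr₂ , _) = ⊥-elim (¬wr₂ (graph₀-wordRepresentable G₂))
theorem12 {suc k₁} {suc k₂} G₁ G₂ (_ , minimal₁) (_ , minimal₂) =
  3 , s≤s z≤n , ≤-refl ,
  lex-wrUnion G₁ G₂ (minimal₁ k₁ (n<1+n k₁) suc suc-injective)
                    (minimal₂ k₂ (n<1+n k₂) suc suc-injective)
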